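{- Let $T$ be a tree with root $r_T$, let $\delta\in[0,1]$ and $k\in\mathbb N$. Assume that for every $\lambda'\in[0,1]$ and every min-max tree $T'$ with root $r_{T'}$ there is a forest $F'\subseteq T'$ containing $r_{T'}$ with at most $k$ components such that $c(F')\le\lambda' c(T')$ and $p(F')\ge\delta\lambda' p(T')$. Then for every $\lambda\in[0,1]$ there is a forest $F\subseteq T$ containing $r_T$ with at most $k$ components such that $c(F)\le\lambda c(T)$ and $p(F)\ge\delta\lambda p(T)$.
   Context: Trees here are finite trees with positive edge costs $c(e)>0$, nonnegative vertex prizes $p(v)\ge0$ and a designated root. For a subgraph $S$, $p(S)$ is the sum of its vertex prizes and $c(S)$ the sum of its edge costs; $d(S)=p(S)/c(S)$ if $c(S)>0$. A forest $F\subseteq T$ is a subgraph of $T$ (a vertex subset and an edge subset among those vertices). A tree $T'$ with root $r_{T'}$ is a min-max tree with root $r_{T'}$ if $p(r_{T'})=0$ and every proper subtree $T''\subsetneq T'$ containing $r_{T'}$ with $c(T'')>0$ satisfies $d(T')>d(T'')$.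
   Formalization: Edge costs, vertex prizes and the parameters δ, λ and λ′ are rational, both for T and for the min-max trees in the hypothesis. -}

module Defs where

open import Data.Rational using (ℚ; 0ℚ; 1ℚ; _+_; _*_; _≤_; _<_)
open import Data.Nat as ℕ using (ℕ)
open import Data.List using (List; []; _∷_)
open import Data.Product using (_×_; _,_; Σ)
open import Data.Bool using (Bool; true; false; if_then_else_)
open import Data.Unit using (⊤)
open import Relation.Binary.PropositionalEquality using (_≡_; _≢_)

-- A finite rooted tree: a node carries its vertex prize p(v) and the list
-- of its children, each paired with the cost c(e) of the edge to it.
-- The root of the tree is the outermost node.
data Tree : Set where
  node : ℚ → List (ℚ × Tree) → Tree

mutual
  WF : Tree → Set
  WF (node p cs) = (0ℚ ≤ p) × WFs cs

  WFs : List (ℚ × Tree) → Set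
  WFs [] = ⊤
  WFs ((c , t) ∷ cs) = (0ℚ < c) × WF t × WFs cs

rootPrize : Tree → ℚ
rootPrize (node p _) = p

-- A subgraph of a tree: a choice of vertices (Bool at each node) and of
-- edges (Bool at each parent→child edge).
mutual
  data Sub : Tree → Set where
    sub : ∀ {p cs} → Bool → Subs cs → Sub (node p cs)

  data Subs : List (ℚ × Tree) → Set where
    []   : Subs []
    cons : ∀ {c t cs} → Bool → Sub t → Subs cs → Subs ((c , t) ∷ cs)

rootIn : ∀ {t} → Sub t → Bool
rootIn (sub b _) = b

b2ℚ : Bool → ℚ → ℚ
b2ℚ b x = if b then x else 0ℚ

b2ℕ : Bool → ℕ
b2ℕ b = if b then 1 else 0

mutual
  prizeS : ∀ {t} → Sub t → ℚ
  prizeS {node p _} (sub b ss) = b2ℚ b p + prizesS ss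

  prizesS : ∀ {cs} → Subs cs → ℚ
  prizesS [] = 0ℚ
  prizesS (cons e s ss) = prizeS s + prizesS ss

mutual
  costS : ∀ {t} → Sub t → ℚ
  costS (sub b ss) = costsS ss

  costsS : ∀ {cs} → Subs cs → ℚ
  costsS [] = 0ℚ
  costsS (cons {c} e s ss) = b2ℚ e c + costS s + costsS ss

mutual
  Valid : ∀ {t} → Sub t → Set
  Valid (sub b ss) = ValidE b ss

  ValidE : ∀ {cs} → Bool → Subs cs → Set
  ValidE b [] = ⊤
  ValidE b (cons e s ss) =
    (e ≡ true → (b ≡ true) × (rootIn s ≡ true)) × Valid s × ValidE b ss

-- Number of connected components of a subforest of a rooted tree: each
-- component has a unique topmost vertex, i.e. a selected vertex that is
-- the root of T or whose parent edge is not selected.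
mutual
  compsBelow : ∀ {t} → Sub t → ℕ
  compsBelow (sub b ss) = compsE ss

  compsE : ∀ {cs} → Subs cs → ℕ
  compsE [] = 0
  compsE (cons e s ss) =
    (if e then 0 else b2ℕ (rootIn s)) ℕ.+ compsBelow s ℕ.+ compsE ss

comps : ∀ {t} → Sub t → ℕ
comps S = b2ℕ (rootIn S) ℕ.+ compsBelow S

mutual
  ConnBelow : ∀ {t} → Sub t → Set
  ConnBelow (sub b ss) = ConnE ss

  ConnE : ∀ {cs} → Subs cs → Set
  ConnE [] = ⊤
  ConnE (cons e s ss) = (rootIn s ≡ true → e ≡ true) × ConnBelow s × ConnE ss

RootedSubtree : ∀ {t} → Sub t → Set
RootedSubtree S = Valid S × (rootIn S ≡ true) × ConnBelow S

mutual
  full : (t : Tree) → Sub t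
  full (node p cs) = sub true (fulls cs)

  fulls : (cs : List (ℚ × Tree)) → Subs cs
  fulls [] = []
  fulls ((c , t) ∷ cs) = cons true (full t) (fulls cs)

treePrize : Tree → ℚ
treePrize t = prizeS (full t)

treeCost : Tree → ℚ
treeCost t = costS (full t)

-- Min-max tree: p(root) = 0 and every proper subtree T'' containing the
-- root with c(T'') > 0 has d(T') > d(T''), written without division as
-- p(T'')·c(T') < p(T')·c(T'')  (both costs are positive).
MinMax : Tree → Set
MinMax t = (rootPrize t ≡ 0ℚ) ×
  ((S : Sub t) → RootedSubtree S → S ≢ full t → 0ℚ < costS S →
     prizeS S * treeCost t < treePrize t * costS S)

GoodForest : ℕ → ℚ → ℚ → Tree → Set
GoodForest k δ lam t = Σ (Sub t) λ F →
  Valid F × (rootIn F ≡ true) × (comps F ℕ.≤ k) ×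
  (costS F ≤ lam * treeCost t) × (δ * lam * treePrize t ≤ prizeS F)

{-# OPTIONS --safe #-}
-- Induction on the number of edges.  Since δλ ≤ 1, a good forest for the tree
-- with root prize 0 stays good when the root prize is restored, so let p(r) = 0.
-- If T is min-max, the hypothesis applies.  Otherwise an exhaustive search finds
-- a proper rooted subtree S with c(S) > 0 and d(S) ≥ d(T); both S and the tree
-- T/S obtained by contracting S into a root of prize 0 have fewer edges.  If
-- λc(T) ≤ c(S), a good forest of S for λ' = λc(T)/c(S) is good for T, as S is
-- denser than T.  Otherwise S together with a good forest of T/S for
-- λ' = (λc(T) − c(S))/c(T/S) costs at most λc(T), and its prize is large enough
-- because p(S) + λ'p(T/S) − λp(T) = (1 − λ)(p(S)c(T) − p(T)c(S))/c(T/S) ≥ 0.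
module Submission where

open import Algebra.Bundles using (CommutativeMonoid)
open import Data.Bool using (Bool; true; false; if_then_else_)
open import Data.Bool.Properties using (_≟_)
open import Data.Empty using (⊥-elim)
open import Data.List using (List; []; _∷_; _++_)
open import Data.Nat as ℕ using (ℕ; suc)
import Data.Nat.Properties as ℕₚ
open import Data.Nat.Induction using (<-wellFounded)
open import Data.Product using (_×_; _,_; proj₁; proj₂; map₁; ∃; ∃-syntax)
open import Data.Rational
  using (ℚ; 0ℚ; 1ℚ; _+_; _*_; _-_; -_; _≤_; _<_; _≤?_; _<?_; 1/_; positive; nonNegative)
open import Data.Rational.Properties hiding (_≟_)
open import Data.Rational.Solver using (module +-*-Solver)
open import Data.Sum using (_⊎_; inj₁; inj₂; [_,_]; [_,_]′)
import Data.Sum as Sum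
open import Data.Unit using (tt)
open import Function using (_∘_)
open import Induction.WellFounded using (module All)
import Relation.Binary.Construct.On as On
open import Relation.Binary.PropositionalEquality
  using (_≡_; _≢_; refl; sym; trans; cong; cong₂; subst; subst₂; module ≡-Reasoning)
open import Relation.Nullary using (¬_; Dec; yes; no; map′; _×-dec_; _⊎-dec_; _→-dec_; contradiction)
open import Relation.Nullary.Decidable using (toSum)
open import Relation.Unary using (Decidable)

open import Defs

import Algebra.Properties.CommutativeSemigroup ℕₚ.+-commutativeSemigroup as ℕ+
import Algebra.Properties.CommutativeSemigroup
  (CommutativeMonoid.commutativeSemigroup +-0-commutativeMonoid) as ℚ+
import Algebra.Properties.CommutativeSemigroup
  (CommutativeMonoid.commutativeSemigroup *-1-commutativeMonoid) as ℚ*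
open +-*-Solver

*-nonNeg : ∀ {p q} → 0ℚ ≤ p → 0ℚ ≤ q → 0ℚ ≤ p * q
*-nonNeg {p} {q} 0≤p 0≤q =
  nonNegative⁻¹ (p * q) {{nonNeg*nonNeg⇒nonNeg p {{nonNegative 0≤p}} q {{nonNegative 0≤q}}}}

p+q-p≡q : ∀ p q → p + q - p ≡ q
p+q-p≡q = solve 2 (λ p q → p :+ q :- p := q) refl

p+[q-p]≡q : ∀ p q → p + (q - p) ≡ q
p+[q-p]≡q = solve 2 (λ p q → p :+ (q :- p) := q) refl

p≤q⇒0≤q-p : ∀ {p q} → p ≤ q → 0ℚ ≤ q - p
p≤q⇒0≤q-p {p} {q} p≤q = subst (_≤ q - p) (+-inverseʳ p) (+-monoˡ-≤ (- p) p≤q)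

p<p+q⇒0<q : ∀ {p q} → p < p + q → 0ℚ < q
p<p+q⇒0<q {p} {q} p<p+q = subst₂ _<_ (+-inverseʳ p) (p+q-p≡q p q) (+-monoˡ-< (- p) p<p+q)

p≤p+q : ∀ {p q} → 0ℚ ≤ q → p ≤ p + q
p≤p+q {p} {q} 0≤q = subst (_≤ p + q) (+-identityʳ p) (+-monoʳ-≤ p 0≤q)

p≤1⇒p*q≤q : ∀ {p q} → p ≤ 1ℚ → 0ℚ ≤ q → p * q ≤ q
p≤1⇒p*q≤q {p} {q} p≤1 0≤q =
  subst (p * q ≤_) (*-identityˡ q) (*-monoʳ-≤-nonNeg q {{nonNegative 0≤q}} p≤1)

p≤1⇒p*[q+r]≤q+p*r : ∀ {p q r} → p ≤ 1ℚ → 0ℚ ≤ q → p * (q + r) ≤ q + p * r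
p≤1⇒p*[q+r]≤q+p*r {p} {q} {r} p≤1 0≤q = begin
  p * (q + r)    ≡⟨ *-distribˡ-+ p q r ⟩
  p * q + p * r  ≤⟨ +-monoˡ-≤ (p * r) (p≤1⇒p*q≤q p≤1 0≤q) ⟩
  q + p * r      ∎
  where open ≤-Reasoning

ratio : ∀ {a b} → 0ℚ ≤ a → a ≤ b → 0ℚ < b → ∃[ μ ] (0ℚ ≤ μ × μ ≤ 1ℚ × μ * b ≡ a)
ratio {a} {b} 0≤a a≤b 0<b = a * 1/ b , 0≤μ , μ≤1 , μb≡a
  where
  instance
    b-pos = positive 0<b
    b≢0 = pos⇒nonZero b
  μb≡a : a * 1/ b * b ≡ a
  μb≡a = begin
    a * 1/ b * b    ≡⟨ *-assoc a (1/ b) b ⟩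
    a * (1/ b * b)  ≡⟨ cong (a *_) (*-inverseˡ b) ⟩
    a * 1ℚ          ≡⟨ *-identityʳ a ⟩
    a               ∎
    where open ≡-Reasoning
  0≤μ : 0ℚ ≤ a * 1/ b
  0≤μ = *-nonNeg 0≤a (<⇒≤ (positive⁻¹ (1/ b) {{1/pos⇒pos b}}))
  μ≤1 : a * 1/ b ≤ 1ℚ
  μ≤1 = *-cancelʳ-≤-pos b (subst₂ _≤_ (sym μb≡a) (sym (*-identityˡ b)) a≤b)

subtree-scale : ∀ {lam c c' P p'} → 0ℚ ≤ lam → 0ℚ ≤ c → 0ℚ < c' → lam * c ≤ c' →
  P * c' ≤ p' * c → ∃[ μ ] (0ℚ ≤ μ × μ ≤ 1ℚ × μ * c' ≡ lam * c × lam * P ≤ μ * p')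
subtree-scale {lam} {c} {c'} {P} {p'} 0≤lam 0≤c 0<c' lamc≤c' P*c'≤p'*c =
  let μ , 0≤μ , μ≤1 , μc'≡lamc = ratio (*-nonNeg 0≤lam 0≤c) lamc≤c' 0<c'
  in  μ , 0≤μ , μ≤1 , μc'≡lamc , lamP≤μp' μ μc'≡lamc
  where
  open ≤-Reasoning
  lamP≤μp' : ∀ μ → μ * c' ≡ lam * c → lam * P ≤ μ * p'
  lamP≤μp' μ μc'≡lamc = *-cancelʳ-≤-pos c' {{positive 0<c'}} (begin
    lam * P * c'    ≡⟨ *-assoc lam P c' ⟩
    lam * (P * c')  ≤⟨ *-monoˡ-≤-nonNeg lam {{nonNegative 0≤lam}} P*c'≤p'*c ⟩
    lam * (p' * c)  ≡⟨ ℚ*.x∙yz≈y∙xz lam p' c ⟩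
    p' * (lam * c)  ≡⟨ cong (p' *_) μc'≡lamc ⟨
    p' * (μ * c')   ≡⟨ ℚ*.x∙yz≈yx∙z p' μ c' ⟩
    μ * p' * c'     ∎)

slack-identity : ∀ lam p' Q C c' →
  lam * (p' + Q) * C + (1ℚ - lam) * (p' * (c' + C) - (p' + Q) * c')
    ≡ p' * C + Q * (lam * (c' + C) - c')
slack-identity = solve 5 (λ l p Q C c →
  l :* (p :+ Q) :* C :+ (con 1ℚ :- l) :* (p :* (c :+ C) :- (p :+ Q) :* c)
    := p :* C :+ Q :* (l :* (c :+ C) :- c)) refl

contraction-scale : ∀ {lam c' C p' Q} → lam ≤ 1ℚ → 0ℚ ≤ c' → 0ℚ < C →
  c' ≤ lam * (c' + C) → (p' + Q) * c' ≤ p' * (c' + C) →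
  ∃[ μ ] (0ℚ ≤ μ × μ ≤ 1ℚ × c' + μ * C ≡ lam * (c' + C) × lam * (p' + Q) ≤ p' + μ * Q)
contraction-scale {lam} {c'} {C} {p'} {Q} lam≤1 0≤c' 0<C c'≤lamc P*c'≤p'*c =
  let μ , 0≤μ , μ≤1 , μC≡lamc-c' = ratio (p≤q⇒0≤q-p c'≤lamc) lamc-c'≤C 0<C
  in  μ , 0≤μ , μ≤1 , trans (cong (c' +_) μC≡lamc-c') (p+[q-p]≡q c' (lam * (c' + C))) ,
      lamP≤p'+μQ μ μC≡lamc-c'
  where
  lamc-c'≤C : lam * (c' + C) - c' ≤ C
  lamc-c'≤C = subst (lam * (c' + C) - c' ≤_) (p+q-p≡q c' C)
    (+-monoˡ-≤ (- c') (p≤1⇒p*q≤q lam≤1 (+-mono-≤ 0≤c' (<⇒≤ 0<C))))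
  open ≤-Reasoning
  lamP≤p'+μQ : ∀ μ → μ * C ≡ lam * (c' + C) - c' → lam * (p' + Q) ≤ p' + μ * Q
  lamP≤p'+μQ μ μC≡lamc-c' = *-cancelʳ-≤-pos C {{positive 0<C}} (begin
    lam * (p' + Q) * C
      ≤⟨ p≤p+q (*-nonNeg (p≤q⇒0≤q-p lam≤1) (p≤q⇒0≤q-p P*c'≤p'*c)) ⟩
    lam * (p' + Q) * C + (1ℚ - lam) * (p' * (c' + C) - (p' + Q) * c')
      ≡⟨ slack-identity lam p' Q C c' ⟩
    p' * C + Q * (lam * (c' + C) - c')
      ≡⟨ cong (λ x → p' * C + Q * x) μC≡lamc-c' ⟨
    p' * C + Q * (μ * C)
      ≡⟨ cong (p' * C +_) (ℚ*.x∙yz≈yx∙z Q μ C) ⟩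
    p' * C + μ * Q * C
      ≡⟨ *-distribʳ-+ C p' (μ * Q) ⟨
    (p' + μ * Q) * C ∎)

mutual
  empty : (t : Tree) → Sub t
  empty (node _ cs) = sub false (emptyE cs)

  emptyE : (cs : List (ℚ × Tree)) → Subs cs
  emptyE [] = []
  emptyE ((_ , t) ∷ cs) = cons false (empty t) (emptyE cs)

mutual
  costS-empty : ∀ t → costS (empty t) ≡ 0ℚ
  costS-empty (node _ cs) = costsS-emptyE cs

  costsS-emptyE : ∀ cs → costsS (emptyE cs) ≡ 0ℚ
  costsS-emptyE [] = refl
  costsS-emptyE ((c , t) ∷ cs) = trans (costsS-drop {c} t (emptyE cs)) (costsS-emptyE cs)

  costsS-drop : ∀ {c} t {cs} (ss : Subs cs) → costsS (cons {c} false (empty t) ss) ≡ costsS ss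
  costsS-drop t ss = begin
    0ℚ + costS (empty t) + costsS ss  ≡⟨ cong (λ x → 0ℚ + x + costsS ss) (costS-empty t) ⟩
    0ℚ + 0ℚ + costsS ss               ≡⟨ cong (_+ costsS ss) (+-identityˡ 0ℚ) ⟩
    0ℚ + costsS ss                    ≡⟨ +-identityˡ (costsS ss) ⟩
    costsS ss                         ∎
    where open ≡-Reasoning

mutual
  prizeS-empty : ∀ t → prizeS (empty t) ≡ 0ℚ
  prizeS-empty (node _ cs) = trans (+-identityˡ (prizesS (emptyE cs))) (prizesS-emptyE cs)

  prizesS-emptyE : ∀ cs → prizesS (emptyE cs) ≡ 0ℚ
  prizesS-emptyE [] = refl
  prizesS-emptyE ((c , t) ∷ cs) = trans (prizesS-drop {c} t (emptyE cs)) (prizesS-emptyE cs)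

  prizesS-drop : ∀ {c} t {cs} (ss : Subs cs) → prizesS (cons {c} false (empty t) ss) ≡ prizesS ss
  prizesS-drop t ss = trans (cong (_+ prizesS ss) (prizeS-empty t)) (+-identityˡ (prizesS ss))

mutual
  compsBelow-empty : ∀ t → compsBelow (empty t) ≡ 0
  compsBelow-empty (node _ cs) = compsE-emptyE cs

  compsE-emptyE : ∀ cs → compsE (emptyE cs) ≡ 0
  compsE-emptyE [] = refl
  compsE-emptyE ((_ , node _ cs′) ∷ cs) = cong₂ ℕ._+_ (compsE-emptyE cs′) (compsE-emptyE cs)

mutual
  valid-empty : ∀ t → Valid (empty t)
  valid-empty (node _ cs) = validE-emptyE cs

  validE-emptyE : ∀ cs → ValidE false (emptyE cs)
  validE-emptyE [] = tt
  validE-emptyE ((_ , t) ∷ cs) = (λ ()) , valid-empty t , validE-emptyE cs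

-- Inductive view of RootedSubtree: nothing is selected below a dropped edge.
mutual
  data Rooted : ∀ {t} → Sub t → Set where
    rooted : ∀ {p cs} {ss : Subs cs} → RootedE ss → Rooted (sub {p} true ss)

  data RootedE : ∀ {cs} → Subs cs → Set where
    []   : RootedE []
    keep : ∀ {c t cs} {s : Sub t} {ss : Subs cs} →
           Rooted s → RootedE ss → RootedE (cons {c} true s ss)
    drop : ∀ {c t cs} {ss : Subs cs} → RootedE ss → RootedE (cons {c} false (empty t) ss)

true⇒false⇒≡false : ∀ {b} → (b ≡ true → false ≡ true) → b ≡ false
true⇒false⇒≡false {false} _ = refl
true⇒false⇒≡false {true} true⇒false with () ← true⇒false refl

mutual
  rootless⇒empty : ∀ {t} (S : Sub t) → Valid S → ConnBelow S → rootIn S ≡ false → S ≡ empty t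
  rootless⇒empty (sub false ss) valid conn refl =
    cong (sub false) (rootless⇒emptyE ss valid conn)

  rootless⇒emptyE : ∀ {cs} (ss : Subs cs) → ValidE false ss → ConnE ss → ss ≡ emptyE cs
  rootless⇒emptyE [] _ _ = refl
  rootless⇒emptyE (cons true _ _) (valid , _) _ with () ← proj₁ (valid refl)
  rootless⇒emptyE (cons false s ss) (_ , valid , valids) (up , conn , conns) =
    cong₂ (cons false)
      (rootless⇒empty s valid conn (true⇒false⇒≡false up))
      (rootless⇒emptyE ss valids conns)

mutual
  rootedSubtree⇒Rooted : ∀ {t} (S : Sub t) → RootedSubtree S → Rooted S
  rootedSubtree⇒Rooted (sub true ss) (valid , refl , conn) = rooted (rootedE valid conn)

  rootedE : ∀ {cs} {ss : Subs cs} → ValidE true ss → ConnE ss → RootedE ss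
  rootedE {ss = []} _ _ = []
  rootedE {ss = cons true s ss} (ends , valid , valids) (_ , conn , conns) =
    keep (rootedSubtree⇒Rooted s (valid , proj₂ (ends refl) , conn)) (rootedE valids conns)
  rootedE {ss = cons false s ss} (_ , valid , valids) (up , conn , conns)
    rewrite rootless⇒empty s valid conn (true⇒false⇒≡false up) =
    drop (rootedE valids conns)

b2ℚ≤ : ∀ b {c} → 0ℚ < c → b2ℚ b c ≤ c
b2ℚ≤ true  _   = ≤-refl
b2ℚ≤ false 0<c = <⇒≤ 0<c

mutual
  costS≤treeCost : ∀ {t} → WF t → (S : Sub t) → costS S ≤ treeCost t
  costS≤treeCost (_ , wfs) (sub _ ss) = costsS≤costsS-fulls wfs ss

  costsS≤costsS-fulls : ∀ {cs} → WFs cs → (ss : Subs cs) → costsS ss ≤ costsS (fulls cs)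
  costsS≤costsS-fulls _ [] = ≤-refl
  costsS≤costsS-fulls (0<c , wf , wfs) (cons e s ss) =
    +-mono-≤ (+-mono-≤ (b2ℚ≤ e 0<c) (costS≤treeCost wf s)) (costsS≤costsS-fulls wfs ss)

mutual
  rooted⇒≡full⊎costS< : ∀ {t} {S : Sub t} → WF t → Rooted S → S ≡ full t ⊎ costS S < treeCost t
  rooted⇒≡full⊎costS< (_ , wfs) (rooted r) =
    Sum.map₁ (cong (sub true)) (rootedE⇒≡fulls⊎costsS< wfs r)

  rootedE⇒≡fulls⊎costsS< : ∀ {cs} {ss : Subs cs} → WFs cs → RootedE ss →
                            ss ≡ fulls cs ⊎ costsS ss < costsS (fulls cs)
  rootedE⇒≡fulls⊎costsS< _ [] = inj₁ refl
  rootedE⇒≡fulls⊎costsS< {ss = cons false s ss} (0<c , wf , wfs) (drop _) =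
    inj₂ (+-mono-<-≤ (+-mono-<-≤ 0<c (costS≤treeCost wf s)) (costsS≤costsS-fulls wfs ss))
  rootedE⇒≡fulls⊎costsS< {ss = cons {c} true s ss} (_ , wf , wfs) (keep r rs)
    with rooted⇒≡full⊎costS< wf r | rootedE⇒≡fulls⊎costsS< wfs rs
  ... | inj₁ refl | inj₁ refl = inj₁ refl
  ... | inj₂ s<   | _         = inj₂ (+-mono-<-≤ (+-monoʳ-< c s<) (costsS≤costsS-fulls wfs ss))
  ... | inj₁ refl | inj₂ ss<  = inj₂ (+-monoʳ-< (c + costS s) ss<)

mutual
  subtree : ∀ {t} → Sub t → Tree
  subtree (sub {p} _ ss) = node p (subtreeE ss)

  subtreeE : ∀ {cs} → Subs cs → List (ℚ × Tree)
  subtreeE [] = []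
  subtreeE (cons {c} true s ss) = (c , subtree s) ∷ subtreeE ss
  subtreeE (cons false _ ss) = subtreeE ss

mutual
  WF-subtree : ∀ {t} → WF t → (S : Sub t) → WF (subtree S)
  WF-subtree (0≤p , wfs) (sub _ ss) = 0≤p , WFs-subtreeE wfs ss

  WFs-subtreeE : ∀ {cs} → WFs cs → (ss : Subs cs) → WFs (subtreeE ss)
  WFs-subtreeE _ [] = tt
  WFs-subtreeE (0<c , wf , wfs) (cons true s ss) = 0<c , WF-subtree wf s , WFs-subtreeE wfs ss
  WFs-subtreeE (_ , _ , wfs) (cons false _ ss) = WFs-subtreeE wfs ss

mutual
  treeCost-subtree : ∀ {t} {S : Sub t} → Rooted S → treeCost (subtree S) ≡ costS S
  treeCost-subtree (rooted r) = costsS-subtreeE r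

  costsS-subtreeE : ∀ {cs} {ss : Subs cs} → RootedE ss →
                    costsS (fulls (subtreeE ss)) ≡ costsS ss
  costsS-subtreeE [] = refl
  costsS-subtreeE (keep {c} r rs) =
    cong₂ (λ x y → c + x + y) (treeCost-subtree r) (costsS-subtreeE rs)
  costsS-subtreeE (drop {c} {t} {ss = ss} rs) =
    trans (costsS-subtreeE rs) (sym (costsS-drop {c} t ss))

mutual
  treePrize-subtree : ∀ {t} {S : Sub t} → Rooted S → treePrize (subtree S) ≡ prizeS S
  treePrize-subtree (rooted {p} r) = cong (p +_) (prizesS-subtreeE r)

  prizesS-subtreeE : ∀ {cs} {ss : Subs cs} → RootedE ss →
                     prizesS (fulls (subtreeE ss)) ≡ prizesS ss
  prizesS-subtreeE [] = refl
  prizesS-subtreeE (keep r rs) = cong₂ _+_ (treePrize-subtree r) (prizesS-subtreeE rs)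
  prizesS-subtreeE (drop {c} {t} {ss = ss} rs) =
    trans (prizesS-subtreeE rs) (sym (prizesS-drop {c} t ss))

mutual
  embed : ∀ {t} (S : Sub t) → Sub (subtree S) → Sub t
  embed (sub _ ss) (sub b fs) = sub b (embedE ss fs)

  embedE : ∀ {cs} (ss : Subs cs) → Subs (subtreeE ss) → Subs cs
  embedE [] [] = []
  embedE (cons true s ss) (cons e f fs) = cons e (embed s f) (embedE ss fs)
  embedE (cons {t = t} false _ ss) fs = cons false (empty t) (embedE ss fs)

rootIn-embed : ∀ {t} (S : Sub t) F → rootIn (embed S F) ≡ rootIn F
rootIn-embed (sub _ _) (sub _ _) = refl

mutual
  costS-embed : ∀ {t} (S : Sub t) F → costS (embed S F) ≡ costS F
  costS-embed (sub _ ss) (sub _ fs) = costsS-embedE ss fs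

  costsS-embedE : ∀ {cs} (ss : Subs cs) fs → costsS (embedE ss fs) ≡ costsS fs
  costsS-embedE [] [] = refl
  costsS-embedE (cons {c} true s ss) (cons e f fs) =
    cong₂ (λ x y → b2ℚ e c + x + y) (costS-embed s f) (costsS-embedE ss fs)
  costsS-embedE (cons {c} {t} false _ ss) fs =
    trans (costsS-drop {c} t (embedE ss fs)) (costsS-embedE ss fs)

mutual
  prizeS-embed : ∀ {t} (S : Sub t) F → prizeS (embed S F) ≡ prizeS F
  prizeS-embed (sub {p} _ ss) (sub b fs) = cong (b2ℚ b p +_) (prizesS-embedE ss fs)

  prizesS-embedE : ∀ {cs} (ss : Subs cs) fs → prizesS (embedE ss fs) ≡ prizesS fs
  prizesS-embedE [] [] = refl
  prizesS-embedE (cons true s ss) (cons e f fs) =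
    cong₂ _+_ (prizeS-embed s f) (prizesS-embedE ss fs)
  prizesS-embedE (cons {c} {t} false _ ss) fs =
    trans (prizesS-drop {c} t (embedE ss fs)) (prizesS-embedE ss fs)

mutual
  compsBelow-embed : ∀ {t} (S : Sub t) F → compsBelow (embed S F) ≡ compsBelow F
  compsBelow-embed (sub _ ss) (sub _ fs) = compsE-embedE ss fs

  compsE-embedE : ∀ {cs} (ss : Subs cs) fs → compsE (embedE ss fs) ≡ compsE fs
  compsE-embedE [] [] = refl
  compsE-embedE (cons true s ss) (cons e f fs)
    rewrite rootIn-embed s f | compsBelow-embed s f | compsE-embedE ss fs = refl
  compsE-embedE (cons {t = t@(node _ _)} false _ ss) fs =
    cong₂ ℕ._+_ (compsBelow-empty t) (compsE-embedE ss fs)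

comps-embed : ∀ {t} (S : Sub t) F → comps (embed S F) ≡ comps F
comps-embed S F = cong₂ ℕ._+_ (cong b2ℕ (rootIn-embed S F)) (compsBelow-embed S F)

mutual
  valid-embed : ∀ {t} (S : Sub t) F → Valid F → Valid (embed S F)
  valid-embed (sub _ ss) (sub b fs) = validE-embedE ss fs

  validE-embedE : ∀ {cs b} (ss : Subs cs) fs → ValidE b fs → ValidE b (embedE ss fs)
  validE-embedE [] [] _ = tt
  validE-embedE (cons true s ss) (cons e f fs) (ends , valid , valids) =
    (λ e≡true → proj₁ (ends e≡true) , trans (rootIn-embed s f) (proj₂ (ends e≡true))) ,
    valid-embed s f valid , validE-embedE ss fs valids
  validE-embedE (cons {t = t} false _ ss) fs valids =
    (λ ()) , valid-empty t , validE-embedE ss fs valids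

mutual
  branches : ∀ {t} → Sub t → List (ℚ × Tree)
  branches (sub _ ss) = branchesE ss

  branchesE : ∀ {cs} → Subs cs → List (ℚ × Tree)
  branchesE [] = []
  branchesE (cons true s ss) = branches s ++ branchesE ss
  branchesE (cons {c} {t} false _ ss) = (c , t) ∷ branchesE ss

contract : ∀ {t} → Sub t → Tree
contract S = node 0ℚ (branches S)

WFs-++ : ∀ xs {ys} → WFs xs → WFs ys → WFs (xs ++ ys)
WFs-++ [] _ wfs = wfs
WFs-++ (_ ∷ xs) (0<c , wf , wfxs) wfs = 0<c , wf , WFs-++ xs wfxs wfs

mutual
  WFs-branches : ∀ {t} → WF t → (S : Sub t) → WFs (branches S)
  WFs-branches (_ , wfs) (sub _ ss) = WFs-branchesE wfs ss

  WFs-branchesE : ∀ {cs} → WFs cs → (ss : Subs cs) → WFs (branchesE ss)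
  WFs-branchesE _ [] = tt
  WFs-branchesE (_ , wf , wfs) (cons true s ss) =
    WFs-++ (branches s) (WFs-branches wf s) (WFs-branchesE wfs ss)
  WFs-branchesE (0<c , wf , wfs) (cons false _ ss) = 0<c , wf , WFs-branchesE wfs ss

WF-contract : ∀ {t} → WF t → (S : Sub t) → WF (contract S)
WF-contract wf S = ≤-refl , WFs-branches wf S

takeSubs : ∀ xs {ys} → Subs (xs ++ ys) → Subs xs
takeSubs [] _ = []
takeSubs (_ ∷ xs) (cons e s fs) = cons e s (takeSubs xs fs)

dropSubs : ∀ xs {ys} → Subs (xs ++ ys) → Subs ys
dropSubs [] fs = fs
dropSubs (_ ∷ xs) (cons _ _ fs) = dropSubs xs fs

costsS-++ : ∀ xs {ys} (fs : Subs (xs ++ ys)) →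
            costsS fs ≡ costsS (takeSubs xs fs) + costsS (dropSubs xs fs)
costsS-++ [] fs = sym (+-identityˡ (costsS fs))
costsS-++ ((c , _) ∷ xs) (cons e s fs) =
  trans (cong (b2ℚ e c + costS s +_) (costsS-++ xs fs))
        (sym (+-assoc (b2ℚ e c + costS s) (costsS (takeSubs xs fs)) (costsS (dropSubs xs fs))))

prizesS-++ : ∀ xs {ys} (fs : Subs (xs ++ ys)) →
             prizesS fs ≡ prizesS (takeSubs xs fs) + prizesS (dropSubs xs fs)
prizesS-++ [] fs = sym (+-identityˡ (prizesS fs))
prizesS-++ (_ ∷ xs) (cons _ s fs) =
  trans (cong (prizeS s +_) (prizesS-++ xs fs))
        (sym (+-assoc (prizeS s) (prizesS (takeSubs xs fs)) (prizesS (dropSubs xs fs))))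

compsE-++ : ∀ xs {ys} (fs : Subs (xs ++ ys)) →
            compsE fs ≡ compsE (takeSubs xs fs) ℕ.+ compsE (dropSubs xs fs)
compsE-++ [] fs = refl
compsE-++ (_ ∷ xs) (cons e s fs) =
  trans (cong (n ℕ.+_) (compsE-++ xs fs))
        (sym (ℕₚ.+-assoc n (compsE (takeSubs xs fs)) (compsE (dropSubs xs fs))))
  where n = (if e then 0 else b2ℕ (rootIn s)) ℕ.+ compsBelow s

validE-++ : ∀ {b} xs {ys} (fs : Subs (xs ++ ys)) → ValidE b fs →
            ValidE b (takeSubs xs fs) × ValidE b (dropSubs xs fs)
validE-++ [] fs valids = tt , valids
validE-++ (_ ∷ xs) (cons _ _ fs) (ends , valid , valids) =
  map₁ (λ validsˡ → ends , valid , validsˡ) (validE-++ xs fs valids)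

takeSubs-fulls : ∀ xs {ys} → takeSubs xs (fulls (xs ++ ys)) ≡ fulls xs
takeSubs-fulls [] = refl
takeSubs-fulls ((_ , t) ∷ xs) = cong (cons true (full t)) (takeSubs-fulls xs)

dropSubs-fulls : ∀ xs {ys} → dropSubs xs (fulls (xs ++ ys)) ≡ fulls ys
dropSubs-fulls [] = refl
dropSubs-fulls (_ ∷ xs) = dropSubs-fulls xs

mutual
  graft : ∀ {t} (S : Sub t) → Subs (branches S) → Sub t
  graft (sub b ss) fs = sub b (graftE ss fs)

  graftE : ∀ {cs} (ss : Subs cs) → Subs (branchesE ss) → Subs cs
  graftE [] [] = []
  graftE (cons true s ss) fs =
    cons true (graft s (takeSubs (branches s) fs)) (graftE ss (dropSubs (branches s) fs))
  graftE (cons false _ ss) (cons e f fs) = cons e f (graftE ss fs)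

mutual
  graft-fulls : ∀ {t} {S : Sub t} → Rooted S → graft S (fulls (branches S)) ≡ full t
  graft-fulls (rooted r) = cong (sub true) (graftE-fulls r)

  graftE-fulls : ∀ {cs} {ss : Subs cs} → RootedE ss → graftE ss (fulls (branchesE ss)) ≡ fulls cs
  graftE-fulls [] = refl
  graftE-fulls (keep {s = s} {ss} r rs)
    rewrite takeSubs-fulls (branches s) {branchesE ss} | dropSubs-fulls (branches s) {branchesE ss} =
    cong₂ (cons true) (graft-fulls r) (graftE-fulls rs)
  graftE-fulls (drop rs) = cong (cons true (full _)) (graftE-fulls rs)

mutual
  costS-graft : ∀ {t} {S : Sub t} → Rooted S → ∀ fs → costS (graft S fs) ≡ costS S + costsS fs
  costS-graft (rooted r) = costsS-graftE r

  costsS-graftE : ∀ {cs} {ss : Subs cs} → RootedE ss → ∀ fs →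
                  costsS (graftE ss fs) ≡ costsS ss + costsS fs
  costsS-graftE [] [] = sym (+-identityˡ 0ℚ)
  costsS-graftE (keep {c} {s = s} {ss} r rs) fs = begin
    c + costS (graft s fsˡ) + costsS (graftE ss fsʳ)
      ≡⟨ cong₂ (λ x y → c + x + y) (costS-graft r fsˡ) (costsS-graftE rs fsʳ) ⟩
    c + (costS s + costsS fsˡ) + (costsS ss + costsS fsʳ)
      ≡⟨ cong (_+ (costsS ss + costsS fsʳ)) (+-assoc c (costS s) (costsS fsˡ)) ⟨
    c + costS s + costsS fsˡ + (costsS ss + costsS fsʳ)
      ≡⟨ ℚ+.interchange (c + costS s) (costsS fsˡ) (costsS ss) (costsS fsʳ) ⟩
    c + costS s + costsS ss + (costsS fsˡ + costsS fsʳ)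
      ≡⟨ cong (c + costS s + costsS ss +_) (costsS-++ (branches s) fs) ⟨
    c + costS s + costsS ss + costsS fs ∎
    where
    open ≡-Reasoning
    fsˡ = takeSubs (branches s) fs
    fsʳ = dropSubs (branches s) fs
  costsS-graftE (drop {c} {t} {ss = ss} rs) (cons e f fs) = begin
    u + costsS (graftE ss fs)    ≡⟨ cong (u +_) (costsS-graftE rs fs) ⟩
    u + (costsS ss + costsS fs)  ≡⟨ ℚ+.x∙yz≈y∙xz u (costsS ss) (costsS fs) ⟩
    costsS ss + (u + costsS fs)  ≡⟨ cong (_+ (u + costsS fs)) (costsS-drop {c} t ss) ⟨
    costsS (cons {c} false (empty t) ss) + (u + costsS fs) ∎
    where
    open ≡-Reasoning
    u = b2ℚ e c + costS f

mutual
  prizeS-graft : ∀ {t} {S : Sub t} → Rooted S → ∀ fs → prizeS (graft S fs) ≡ prizeS S + prizesS fs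
  prizeS-graft (rooted {p} {ss = ss} r) fs =
    trans (cong (p +_) (prizesS-graftE r fs)) (sym (+-assoc p (prizesS ss) (prizesS fs)))

  prizesS-graftE : ∀ {cs} {ss : Subs cs} → RootedE ss → ∀ fs →
                   prizesS (graftE ss fs) ≡ prizesS ss + prizesS fs
  prizesS-graftE [] [] = sym (+-identityˡ 0ℚ)
  prizesS-graftE (keep {s = s} {ss} r rs) fs = begin
    prizeS (graft s fsˡ) + prizesS (graftE ss fsʳ)
      ≡⟨ cong₂ _+_ (prizeS-graft r fsˡ) (prizesS-graftE rs fsʳ) ⟩
    (prizeS s + prizesS fsˡ) + (prizesS ss + prizesS fsʳ)
      ≡⟨ ℚ+.interchange (prizeS s) (prizesS fsˡ) (prizesS ss) (prizesS fsʳ) ⟩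
    prizeS s + prizesS ss + (prizesS fsˡ + prizesS fsʳ)
      ≡⟨ cong (prizeS s + prizesS ss +_) (prizesS-++ (branches s) fs) ⟨
    prizeS s + prizesS ss + prizesS fs ∎
    where
    open ≡-Reasoning
    fsˡ = takeSubs (branches s) fs
    fsʳ = dropSubs (branches s) fs
  prizesS-graftE (drop {c} {t} {ss = ss} rs) (cons e f fs) = begin
    prizeS f + prizesS (graftE ss fs)
      ≡⟨ cong (prizeS f +_) (prizesS-graftE rs fs) ⟩
    prizeS f + (prizesS ss + prizesS fs)
      ≡⟨ ℚ+.x∙yz≈y∙xz (prizeS f) (prizesS ss) (prizesS fs) ⟩
    prizesS ss + (prizeS f + prizesS fs)
      ≡⟨ cong (_+ (prizeS f + prizesS fs)) (prizesS-drop {c} t ss) ⟨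
    prizesS (cons {c} false (empty t) ss) + (prizeS f + prizesS fs) ∎
    where open ≡-Reasoning

mutual
  compsBelow-graft : ∀ {t} (S : Sub t) fs → compsBelow (graft S fs) ≡ compsE fs
  compsBelow-graft (sub _ ss) = compsE-graftE ss

  compsE-graftE : ∀ {cs} (ss : Subs cs) fs → compsE (graftE ss fs) ≡ compsE fs
  compsE-graftE [] [] = refl
  compsE-graftE (cons true s ss) fs =
    trans (cong₂ ℕ._+_ (compsBelow-graft s (takeSubs (branches s) fs))
                       (compsE-graftE ss (dropSubs (branches s) fs)))
          (sym (compsE-++ (branches s) fs))
  compsE-graftE (cons false _ ss) (cons e f fs) = cong (_ ℕ.+_) (compsE-graftE ss fs)

mutual
  valid-graft : ∀ {t} {S : Sub t} → Rooted S → ∀ fs → ValidE true fs → Valid (graft S fs)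
  valid-graft (rooted r) = validE-graftE r

  validE-graftE : ∀ {cs} {ss : Subs cs} → RootedE ss → ∀ fs → ValidE true fs →
                  ValidE true (graftE ss fs)
  validE-graftE [] [] _ = tt
  validE-graftE (keep {s = s} r@(rooted _) rs) fs valids =
    (λ _ → refl , refl) , valid-graft r _ validsˡ , validE-graftE rs _ validsʳ
    where
    validsˡ = proj₁ (validE-++ {true} (branches s) fs valids)
    validsʳ = proj₂ (validE-++ {true} (branches s) fs valids)
  validE-graftE (drop rs) (cons e f fs) (ends , valid , valids) =
    ends , valid , validE-graftE rs fs valids

treeCost-split : ∀ {t} {S : Sub t} → Rooted S → treeCost t ≡ costS S + treeCost (contract S)
treeCost-split {S = S} r =
  trans (cong costS (sym (graft-fulls r))) (costS-graft r (fulls (branches S)))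

treePrize-split : ∀ {t} {S : Sub t} → Rooted S →
                  treePrize t ≡ prizeS S + prizesS (fulls (branches S))
treePrize-split {S = S} r =
  trans (cong prizeS (sym (graft-fulls r))) (prizeS-graft r (fulls (branches S)))

mutual
  size : Tree → ℕ
  size (node _ cs) = sizeE cs

  sizeE : List (ℚ × Tree) → ℕ
  sizeE [] = 0
  sizeE ((_ , t) ∷ cs) = suc (size t ℕ.+ sizeE cs)

sizeE-++ : ∀ xs ys → sizeE (xs ++ ys) ≡ sizeE xs ℕ.+ sizeE ys
sizeE-++ [] ys = refl
sizeE-++ ((_ , t) ∷ xs) ys =
  cong suc (trans (cong (size t ℕ.+_) (sizeE-++ xs ys))
                  (sym (ℕₚ.+-assoc (size t) (sizeE xs) (sizeE ys))))

mutual
  size-subtree+size-contract : ∀ {t} (S : Sub t) → size (subtree S) ℕ.+ size (contract S) ≡ size t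
  size-subtree+size-contract (sub _ ss) = sizeE-subtreeE+branchesE ss

  sizeE-subtreeE+branchesE : ∀ {cs} (ss : Subs cs) →
                             sizeE (subtreeE ss) ℕ.+ sizeE (branchesE ss) ≡ sizeE cs
  sizeE-subtreeE+branchesE [] = refl
  sizeE-subtreeE+branchesE (cons {t = t} {cs} true s ss) = begin
    suc (a ℕ.+ b) ℕ.+ sizeE (branches s ++ branchesE ss)
      ≡⟨ cong (suc (a ℕ.+ b) ℕ.+_) (sizeE-++ (branches s) (branchesE ss)) ⟩
    suc ((a ℕ.+ b) ℕ.+ (x ℕ.+ y))
      ≡⟨ cong suc (ℕ+.interchange a b x y) ⟩
    suc ((a ℕ.+ x) ℕ.+ (b ℕ.+ y))
      ≡⟨ cong suc (cong₂ ℕ._+_ (size-subtree+size-contract s) (sizeE-subtreeE+branchesE ss)) ⟩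
    suc (size t ℕ.+ sizeE cs) ∎
    where
    open ≡-Reasoning
    a = size (subtree s)
    b = sizeE (subtreeE ss)
    x = size (contract s)
    y = sizeE (branchesE ss)
  sizeE-subtreeE+branchesE (cons {t = t} {cs} false _ ss) = begin
    b ℕ.+ suc (size t ℕ.+ y)    ≡⟨ ℕₚ.+-suc b (size t ℕ.+ y) ⟩
    suc (b ℕ.+ (size t ℕ.+ y))  ≡⟨ cong suc (ℕ+.x∙yz≈y∙xz b (size t) y) ⟩
    suc (size t ℕ.+ (b ℕ.+ y))  ≡⟨ cong (λ z → suc (size t ℕ.+ z)) (sizeE-subtreeE+branchesE ss) ⟩
    suc (size t ℕ.+ sizeE cs)   ∎
    where
    open ≡-Reasoning
    b = sizeE (subtreeE ss)
    y = sizeE (branchesE ss)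

0<treeCost⇒0<size : ∀ t → 0ℚ < treeCost t → 0 ℕ.< size t
0<treeCost⇒0<size (node _ []) 0<0 = ⊥-elim (<-irrefl refl 0<0)
0<treeCost⇒0<size (node _ (_ ∷ _)) _ = ℕ.z<s

mutual
  valid? : ∀ {t} (S : Sub t) → Dec (Valid S)
  valid? (sub b ss) = validE? b ss

  validE? : ∀ {cs} b (ss : Subs cs) → Dec (ValidE b ss)
  validE? b [] = yes tt
  validE? b (cons e s ss) =
    (e ≟ true →-dec b ≟ true ×-dec rootIn s ≟ true) ×-dec valid? s ×-dec validE? b ss

mutual
  connBelow? : ∀ {t} (S : Sub t) → Dec (ConnBelow S)
  connBelow? (sub _ ss) = connE? ss

  connE? : ∀ {cs} (ss : Subs cs) → Dec (ConnE ss)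
  connE? [] = yes tt
  connE? (cons e s ss) = (rootIn s ≟ true →-dec e ≟ true) ×-dec connBelow? s ×-dec connE? ss

rootedSubtree? : ∀ {t} (S : Sub t) → Dec (RootedSubtree S)
rootedSubtree? S = valid? S ×-dec rootIn S ≟ true ×-dec connBelow? S

∃Bool? : {P : Bool → Set} → Decidable P → Dec (∃ P)
∃Bool? P? = map′ [ (true ,_) , (false ,_) ] (λ { (true , p) → inj₁ p ; (false , p) → inj₂ p })
                 (P? true ⊎-dec P? false)

mutual
  ∃Sub? : ∀ t {P : Sub t → Set} → Decidable P → Dec (∃ P)
  ∃Sub? (node _ cs) P? =
    map′ (λ (b , ss , p) → sub b ss , p) (λ { (sub b ss , p) → b , ss , p })
         (∃Bool? λ b → ∃Subs? cs λ ss → P? (sub b ss))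

  ∃Subs? : ∀ cs {P : Subs cs → Set} → Decidable P → Dec (∃ P)
  ∃Subs? [] P? = map′ ([] ,_) (λ { ([] , p) → p }) (P? [])
  ∃Subs? ((_ , t) ∷ cs) P? =
    map′ (λ (e , s , ss , p) → cons e s ss , p) (λ { (cons e s ss , p) → e , s , ss , p })
         (∃Bool? λ e → ∃Sub? t λ s → ∃Subs? cs λ ss → P? (cons e s ss))

mutual
  prizeS-nonNeg : ∀ {t} → WF t → (S : Sub t) → 0ℚ ≤ prizeS S
  prizeS-nonNeg (0≤p , wfs) (sub true ss) = +-mono-≤ 0≤p (prizesS-nonNeg wfs ss)
  prizeS-nonNeg (_ , wfs) (sub false ss) = +-mono-≤ ≤-refl (prizesS-nonNeg wfs ss)

  prizesS-nonNeg : ∀ {cs} → WFs cs → (ss : Subs cs) → 0ℚ ≤ prizesS ss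
  prizesS-nonNeg _ [] = ≤-refl
  prizesS-nonNeg (_ , wf , wfs) (cons _ s ss) =
    +-mono-≤ (prizeS-nonNeg wf s) (prizesS-nonNeg wfs ss)

Approximable : ℕ → ℚ → Tree → Set
Approximable k δ t = ∀ lam → 0ℚ ≤ lam → lam ≤ 1ℚ → GoodForest k δ lam t

DenseSubtree : (t : Tree) → Sub t → Set
DenseSubtree t S = RootedSubtree S × 0ℚ < costS S × costS S < treeCost t ×
                   treePrize t * costS S ≤ prizeS S * treeCost t

denseSubtree? : ∀ t (S : Sub t) → Dec (DenseSubtree t S)
denseSubtree? t S = rootedSubtree? S ×-dec 0ℚ <? costS S ×-dec costS S <? treeCost t ×-dec
                    treePrize t * costS S ≤? prizeS S * treeCost t

¬denseSubtree⇒MinMax : ∀ {cs} → WFs cs → ¬ ∃ (DenseSubtree (node 0ℚ cs)) → MinMax (node 0ℚ cs)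
¬denseSubtree⇒MinMax {cs} wfs ¬dense = refl , sparse
  where
  t = node 0ℚ cs
  sparse : ∀ S → RootedSubtree S → S ≢ full t → 0ℚ < costS S →
           prizeS S * treeCost t < treePrize t * costS S
  sparse S rs S≢full 0<c' with rooted⇒≡full⊎costS< (≤-refl , wfs) (rootedSubtree⇒Rooted S rs)
  ... | inj₁ S≡full = contradiction S≡full S≢full
  ... | inj₂ c'<c   = ≰⇒> λ dense → ¬dense (S , rs , 0<c' , c'<c , dense)

0<treeCost-contract : ∀ {t} (S : Sub t) → DenseSubtree t S → 0ℚ < treeCost (contract S)
0<treeCost-contract S (rs , _ , c'<c , _) =
  p<p+q⇒0<q (subst (costS S <_) (treeCost-split (rootedSubtree⇒Rooted S rs)) c'<c)

size-subtree< : ∀ {t} (S : Sub t) → DenseSubtree t S → size (subtree S) ℕ.< size t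
size-subtree< S dense = subst (size (subtree S) ℕ.<_) (size-subtree+size-contract S)
  (ℕₚ.m<m+n (size (subtree S)) (0<treeCost⇒0<size (contract S) (0<treeCost-contract S dense)))

size-contract< : ∀ {t} (S : Sub t) → DenseSubtree t S → size (contract S) ℕ.< size t
size-contract< S (rs , 0<c' , _) = subst (size (contract S) ℕ.<_) (size-subtree+size-contract S)
  (ℕₚ.m<n+m (size (contract S)) (0<treeCost⇒0<size (subtree S)
    (subst (0ℚ <_) (sym (treeCost-subtree (rootedSubtree⇒Rooted S rs))) 0<c')))

goodForest-rootPrize : ∀ {k δ lam p cs} → δ ≤ 1ℚ → 0ℚ ≤ lam → lam ≤ 1ℚ → 0ℚ ≤ p →
  GoodForest k δ lam (node 0ℚ cs) → GoodForest k δ lam (node p cs)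
goodForest-rootPrize {k} {δ} {lam} {p} {cs} δ≤1 0≤lam lam≤1 0≤p
                     (sub _ fs , valid , refl , comps≤k , cost≤ , prize≥) =
  sub true fs , valid , refl , comps≤k , cost≤ , (begin
    δ * lam * (p + P)  ≤⟨ p≤1⇒p*[q+r]≤q+p*r (≤-trans (p≤1⇒p*q≤q δ≤1 0≤lam) lam≤1) 0≤p ⟩
    p + δ * lam * P    ≤⟨ +-monoʳ-≤ p (subst₂ _≤_ (cong (δ * lam *_) (+-identityˡ P))
                                                  (+-identityˡ (prizesS fs)) prize≥) ⟩
    p + prizesS fs     ∎)
  where
  open ≤-Reasoning
  P = prizesS (fulls cs)

goodForest-subtree : ∀ {k δ t lam μ} {S : Sub t} → 0ℚ ≤ δ → Rooted S →
  GoodForest k δ μ (subtree S) → μ * costS S ≤ lam * treeCost t → lam * treePrize t ≤ μ * prizeS S →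
  GoodForest k δ lam t
goodForest-subtree {k} {δ} {t} {lam} {μ} {S} 0≤δ r (F , valid , root , comps≤k , cost≤ , prize≥)
                   μc'≤lamc lamP≤μp' =
  embed S F , valid-embed S F valid , trans (rootIn-embed S F) root ,
  subst (ℕ._≤ k) (sym (comps-embed S F)) comps≤k , cost≤lamc , δlamP≤prize
  where
  open ≤-Reasoning
  cost≤lamc = begin
    costS (embed S F)        ≡⟨ costS-embed S F ⟩
    costS F                  ≤⟨ cost≤ ⟩
    μ * treeCost (subtree S) ≡⟨ cong (μ *_) (treeCost-subtree r) ⟩
    μ * costS S              ≤⟨ μc'≤lamc ⟩
    lam * treeCost t         ∎
  δlamP≤prize = begin
    δ * lam * treePrize t          ≡⟨ *-assoc δ lam (treePrize t) ⟩
    δ * (lam * treePrize t)        ≤⟨ *-monoˡ-≤-nonNeg δ {{nonNegative 0≤δ}} lamP≤μp' ⟩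
    δ * (μ * prizeS S)             ≡⟨ *-assoc δ μ (prizeS S) ⟨
    δ * μ * prizeS S               ≡⟨ cong (δ * μ *_) (treePrize-subtree r) ⟨
    δ * μ * treePrize (subtree S)  ≤⟨ prize≥ ⟩
    prizeS F                       ≡⟨ prizeS-embed S F ⟨
    prizeS (embed S F)             ∎

-- The component of F at the root of contract S becomes the component of S.
goodForest-contract : ∀ {k δ t lam μ} {S : Sub t} → Rooted S → GoodForest k δ μ (contract S) →
  costS S + μ * treeCost (contract S) ≤ lam * treeCost t →
  δ * lam * treePrize t ≤ prizeS S + δ * μ * treePrize (contract S) → GoodForest k δ lam t
goodForest-contract {k} {δ} {t} {lam} {μ} {S} r@(rooted _)
                    (sub _ fs , valid , refl , comps≤k , cost≤ , prize≥) cost-bound prize-bound =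
  graft S fs , valid-graft r fs valid , refl ,
  subst (ℕ._≤ k) (cong suc (sym (compsBelow-graft S fs))) comps≤k , cost≤lamc , δlamP≤prize
  where
  open ≤-Reasoning
  cost≤lamc = begin
    costS (graft S fs)                   ≡⟨ costS-graft r fs ⟩
    costS S + costsS fs                  ≤⟨ +-monoʳ-≤ (costS S) cost≤ ⟩
    costS S + μ * treeCost (contract S)  ≤⟨ cost-bound ⟩
    lam * treeCost t                     ∎
  δlamP≤prize = begin
    δ * lam * treePrize t                      ≤⟨ prize-bound ⟩
    prizeS S + δ * μ * treePrize (contract S)  ≤⟨ +-monoʳ-≤ (prizeS S) prize≥ ⟩
    prizeS S + (0ℚ + prizesS fs)               ≡⟨ cong (prizeS S +_) (+-identityˡ (prizesS fs)) ⟩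
    prizeS S + prizesS fs                      ≡⟨ prizeS-graft r fs ⟨
    prizeS (graft S fs)                        ∎

module _ {k : ℕ} {δ : ℚ} (0≤δ : 0ℚ ≤ δ) (δ≤1 : δ ≤ 1ℚ) where

  approximable-dense : ∀ {t} {S : Sub t} → WF t → DenseSubtree t S →
    Approximable k δ (subtree S) → Approximable k δ (contract S) → Approximable k δ t
  approximable-dense {t} {S} wf dense@(rs , 0<c' , c'<c , P*c'≤p'*c) approxS approxC lam 0≤lam lam≤1 =
    [ viaSubtree , viaContraction ∘ ≰⇒> ]′ (toSum (lam * treeCost t ≤? costS S))
    where
    r = rootedSubtree⇒Rooted S rs
    Q = prizesS (fulls (branches S))
    c≡c'+C = treeCost-split r
    P≡p'+Q = treePrize-split r

    viaSubtree : lam * treeCost t ≤ costS S → GoodForest k δ lam t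
    viaSubtree lamc≤c' =
      let μ , 0≤μ , μ≤1 , μc'≡lamc , lamP≤μp' =
            subtree-scale 0≤lam (<⇒≤ (<-trans 0<c' c'<c)) 0<c' lamc≤c' P*c'≤p'*c
      in  goodForest-subtree 0≤δ r (approxS μ 0≤μ μ≤1) (≤-reflexive μc'≡lamc) lamP≤μp'

    prize-bound : ∀ μ → lam * (prizeS S + Q) ≤ prizeS S + μ * Q →
                  δ * lam * treePrize t ≤ prizeS S + δ * μ * treePrize (contract S)
    prize-bound μ lamP≤p'+μQ = begin
      δ * lam * treePrize t        ≡⟨ cong (δ * lam *_) P≡p'+Q ⟩
      δ * lam * (prizeS S + Q)     ≡⟨ *-assoc δ lam (prizeS S + Q) ⟩
      δ * (lam * (prizeS S + Q))   ≤⟨ *-monoˡ-≤-nonNeg δ {{nonNegative 0≤δ}} lamP≤p'+μQ ⟩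
      δ * (prizeS S + μ * Q)       ≤⟨ p≤1⇒p*[q+r]≤q+p*r δ≤1 (prizeS-nonNeg wf S) ⟩
      prizeS S + δ * (μ * Q)       ≡⟨ cong (prizeS S +_) (*-assoc δ μ Q) ⟨
      prizeS S + δ * μ * Q         ≡⟨ cong (λ x → prizeS S + δ * μ * x) (+-identityˡ Q) ⟨
      prizeS S + δ * μ * (0ℚ + Q)  ∎
      where open ≤-Reasoning

    viaContraction : costS S < lam * treeCost t → GoodForest k δ lam t
    viaContraction c'<lamc =
      let μ , 0≤μ , μ≤1 , c'+μC≡lamc , lamP≤p'+μQ =
            contraction-scale {p' = prizeS S} {Q} lam≤1 (<⇒≤ 0<c') (0<treeCost-contract S dense)
              (<⇒≤ (subst (λ c → costS S < lam * c) c≡c'+C c'<lamc))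
              (subst₂ (λ P c → P * costS S ≤ prizeS S * c) P≡p'+Q c≡c'+C P*c'≤p'*c)
      in  goodForest-contract {δ = δ} {lam = lam} {μ = μ} r (approxC μ 0≤μ μ≤1)
            (≤-reflexive (trans c'+μC≡lamc (cong (lam *_) (sym c≡c'+C))))
            (prize-bound μ lamP≤p'+μQ)

  approximable : (∀ t → WF t → MinMax t → Approximable k δ t) → ∀ t → WF t → Approximable k δ t
  approximable approxMinMax =
    All.wfRec (On.wellFounded size <-wellFounded) _ (λ t → WF t → Approximable k δ t) step
    where
    step : ∀ t → (∀ {t'} → size t' ℕ.< size t → WF t' → Approximable k δ t') →
           WF t → Approximable k δ t
    step (node p cs) rec (0≤p , wfs) lam 0≤lam lam≤1 =
      goodForest-rootPrize δ≤1 0≤lam lam≤1 0≤p (approx₀ lam 0≤lam lam≤1)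
      where
      t₀ = node 0ℚ cs
      wf₀ : WF t₀
      wf₀ = ≤-refl , wfs
      approx₀ : Approximable k δ t₀
      approx₀ with ∃Sub? t₀ (denseSubtree? t₀)
      ... | no ¬dense = approxMinMax t₀ wf₀ (¬denseSubtree⇒MinMax wfs ¬dense)
      ... | yes (S , dense) = approximable-dense wf₀ dense
                                (rec (size-subtree< S dense) (WF-subtree wf₀ S))
                                (rec (size-contract< S dense) (WF-contract wf₀ S))

lemma17 : (T : Tree) → WF T → (δ : ℚ) → 0ℚ ≤ δ → δ ≤ 1ℚ → (k : ℕ) →
    ((lam' : ℚ) → 0ℚ ≤ lam' → lam' ≤ 1ℚ →
      (T' : Tree) → WF T' → MinMax T' → GoodForest k δ lam' T') →
    (lam : ℚ) → 0ℚ ≤ lam → lam ≤ 1ℚ → GoodForest k δ lam T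
lemma17 T wf δ 0≤δ δ≤1 k minMax-good = approximable 0≤δ δ≤1 approxMinMax T wf
  where
  approxMinMax : ∀ t → WF t → MinMax t → Approximable k δ t
  approxMinMax t wf mm lam 0≤lam lam≤1 = minMax-good lam 0≤lam lam≤1 t wf mm
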